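{- Let $G$ be a finite abelian group and $p$ an odd prime. Assume there exists an automorphism $\alpha$ of $G$ of order $p$ whose only fixed point is the zero element of $G$. Then $\mathbb{Z}_p\times G$ is not a CI-group with respect to color ternary relational structures. Moreover, if there exists a ternary relational structure with vertex set $G$ whose automorphism group is $\langle G_L,\alpha\rangle$ (with $G_L$ acting by translation and $\alpha$ acting as an automorphism), then $\mathbb{Z}_p\times G$ is not a CI-group with respect to ternary relational structures.
   Context: A (color) ternary relational structure is a pair $X=(V,E)$ with $E\subseteq V^3$ (resp. $X=(V,(E_1,\ldots,E_c))$ with pairwise disjoint $E_i\subseteq V^3$); automorphisms are permutations of $V$ preserving $E$ (resp. each $E_i$). For a group $H$, $H_L=\{h\mapsto gh: g\in H\}$. $X$ is a Cayley object of $H$ if $V=H$ and $H_L\le\mathrm{Aut}(X)$. $H$ is a CI-group with respect to a class $\mathcal{C}$ of Cayley objects of $H$ if any two $X,Y\in\mathcal{C}$ are isomorphic if and only if they are isomorphic via a group automorphism of $H$. -}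

module Defs where

open import Data.Nat using (ℕ; zero; suc; _+_; _<_; NonZero)
open import Data.Nat.DivMod using (_mod_)
open import Data.Nat.Primality using (Prime; prime⇒nonZero)
open import Data.Fin using (Fin; toℕ)
open import Data.Bool using (Bool; true)
open import Data.Product using (Σ; ∃; _×_; _,_)
open import Data.List using (List; []; _∷_)
open import Relation.Binary.PropositionalEquality using (_≡_)
open import Function.Bundles using (_↔_; Inverse; _⇔_)
open import Algebra.Structures using (IsAbelianGroup)

record FinAbGroup : Set₁ where
  field
    Carrier        : Set
    _∙_            : Carrier → Carrier → Carrier
    0#             : Carrier
    -_             : Carrier → Carrier
    isAbelianGroup : IsAbelianGroup _≡_ _∙_ 0# -_
    size           : ℕ
    enum           : Carrier ↔ Fin size

zpAdd : (p : ℕ) → Prime p → Fin p → Fin p → Fin p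
zpAdd p pp a b = (toℕ a + toℕ b) mod p
  where instance _ = prime⇒nonZero pp

prodOp : (p : ℕ) → Prime p → (G : FinAbGroup) →
         (Fin p × FinAbGroup.Carrier G) → (Fin p × FinAbGroup.Carrier G) →
         (Fin p × FinAbGroup.Carrier G)
prodOp p pp G (a , x) (b , y) = zpAdd p pp a b , FinAbGroup._∙_ G x y

iter : {A : Set} → (A → A) → ℕ → A → A
iter f zero    x = x
iter f (suc k) x = f (iter f k x)

IsHom : {H : Set} → (H → H → H) → (H → H) → Set
IsHom {H} _∙_ σ = ∀ (x y : H) → σ (x ∙ y) ≡ σ x ∙ σ y

GroupAut : {H : Set} → (H → H → H) → Set
GroupAut {H} _∙_ = Σ (H ↔ H) λ σ → IsHom _∙_ (Inverse.to σ)

Ternary : Set → Set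
Ternary V = V → V → V → Bool

-- f : V → V maps X isomorphically onto Y (f assumed bijective separately)
IsoVia : {V : Set} → (V → V) → Ternary V → Ternary V → Set
IsoVia {V} f X Y = ∀ (x y z : V) → Y (f x) (f y) (f z) ≡ X x y z

Isomorphic : {V : Set} → Ternary V → Ternary V → Set
Isomorphic {V} X Y = Σ (V ↔ V) λ f → IsoVia (Inverse.to f) X Y

IsAut : {V : Set} → Ternary V → (V ↔ V) → Set
IsAut X f = IsoVia (Inverse.to f) X X

IsCayley : {H : Set} → (H → H → H) → Ternary H → Set
IsCayley {H} _∙_ X = ∀ (g x y z : H) → X (g ∙ x) (g ∙ y) (g ∙ z) ≡ X x y z

IsCI-Ternary : {H : Set} → (H → H → H) → Set
IsCI-Ternary {H} _∙_ =
  ∀ (X Y : Ternary H) → IsCayley _∙_ X → IsCayley _∙_ Y →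
    (Isomorphic X Y ⇔ Σ (GroupAut _∙_) λ σ → IsoVia (Inverse.to (Data.Product.proj₁ σ)) X Y)

record ColorTernary (V : Set) (c : ℕ) : Set where
  field
    rel      : Fin c → Ternary V
    disjoint : ∀ (i j : Fin c) (x y z : V) →
               rel i x y z ≡ true → rel j x y z ≡ true → i ≡ j
open ColorTernary public

CIsoVia : {V : Set} {c : ℕ} → (V → V) → ColorTernary V c → ColorTernary V c → Set
CIsoVia {V} {c} f X Y = ∀ (i : Fin c) → IsoVia f (rel X i) (rel Y i)

CIsomorphic : {V : Set} {c : ℕ} → ColorTernary V c → ColorTernary V c → Set
CIsomorphic {V} X Y = Σ (V ↔ V) λ f → CIsoVia (Inverse.to f) X Y

IsCayleyC : {H : Set} {c : ℕ} → (H → H → H) → ColorTernary H c → Set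
IsCayleyC {c = c} _∙_ X = ∀ (i : Fin c) → IsCayley _∙_ (rel X i)

IsCI-ColorTernary : {H : Set} → (H → H → H) → Set
IsCI-ColorTernary {H} _∙_ =
  ∀ (c : ℕ) (X Y : ColorTernary H c) → IsCayleyC _∙_ X → IsCayleyC _∙_ Y →
    (CIsomorphic X Y ⇔ Σ (GroupAut _∙_) λ σ → CIsoVia (Inverse.to (Data.Product.proj₁ σ)) X Y)

-- The subgroup ⟨G_L, α⟩ of Sym(G), as words in the generators and their inverses

data Gen (G : FinAbGroup) : Set where
  transl   : FinAbGroup.Carrier G → Gen G   -- h ↦ g ∙ h (inverse is transl (- g))
  alpha    : Gen G
  alphaInv : Gen G

evalWord : (G : FinAbGroup) → (FinAbGroup.Carrier G ↔ FinAbGroup.Carrier G) →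
           List (Gen G) → FinAbGroup.Carrier G → FinAbGroup.Carrier G
evalWord G α []                x = x
evalWord G α (transl g ∷ w)    x = FinAbGroup._∙_ G g (evalWord G α w x)
evalWord G α (alpha ∷ w)       x = Inverse.to α (evalWord G α w x)
evalWord G α (alphaInv ∷ w)    x = Inverse.from α (evalWord G α w x)

InGenerated : (G : FinAbGroup) → (FinAbGroup.Carrier G ↔ FinAbGroup.Carrier G) →
              (FinAbGroup.Carrier G → FinAbGroup.Carrier G) → Set
InGenerated G α f = ∃ λ (w : List (Gen G)) → ∀ x → f x ≡ evalWord G α w x

-- Write the points of ℤ_p × G as (i , x). Let X and Y both contain the triples inside one
-- fibre with z + αx = x + αy, and the triples over three consecutive fibres i, i+1, i+2 with
-- x + αz = y + αy (in X), respectively z + αx = y + αy (in Y). These conditions are invariant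
-- under translation, so X and Y are Cayley objects, and since α^p = 1 the twist
-- (i , x) ↦ (i , αⁱ x) is an isomorphism X → Y. A group automorphism σ carrying X to Y must keep
-- the fibre 0 (the images of the flat triples (0 , (0 , g) , (0 , αg)) lie in fibres 0 or 1, and p > 2)
-- and fix (1 , 0), so σ (i , x) = (i , γ x) with γ commuting with α; a rising triple then forces
-- α²(γ x) = γ x. As p is odd and α is fixed-point-free this gives γ = 0, impossible for α ≠ 1.

module Submission where

open import Defs
open import Data.Nat using (ℕ; _<_)
open import Data.Nat.Divisibility using (_∣_)
open import Data.Nat.Primality using (Prime)
open import Data.Product using (Σ; _×_)
open import Relation.Nullary using (¬_)
open import Relation.Binary.PropositionalEquality using (_≡_)
open import Function.Bundles using (_↔_; Inverse; _⇔_)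

open import Algebra.Bundles using (AbelianGroup)
import Algebra.Properties.AbelianGroup as AbelianGroupProperties
import Algebra.Properties.CommutativeSemigroup as CommutativeSemigroupProperties
open import Data.Bool using (true)
open import Data.Empty using (⊥; ⊥-elim)
open import Data.Fin using (Fin; zero; suc; toℕ)
open import Data.Fin.Properties using (toℕ-fromℕ<; toℕ-injective; toℕ<n; _≟_)
open import Data.Nat using (zero; suc; _+_; _*_; _∸_; _%_; _/_; z≤n; s≤s)
open import Data.Nat.DivMod using (%-distribˡ-+; m%n%n≡m%n; m≡m%n+[m/n]*n; [m+n]%n≡m%n; m<n⇒m%n≡m)
open import Data.Nat.Divisibility using (∣m∣n⇒∣m+n; ∣-refl; _∣0)
open import Data.Nat.Properties using (+-comm; +-assoc; m∸n+n≡m; <⇒≤)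
open import Data.Product using (_,_; proj₁; proj₂)
open import Data.Product.Function.NonDependent.Propositional using (_×-⇔_)
open import Data.Sum using (_⊎_; inj₁; inj₂)
open import Data.Sum.Function.Propositional using (_⊎-⇔_)
open import Function.Base using (id; _∘_)
open import Function.Bundles using (Equivalence; Injection; mk⇔; mk↔ₛ′)
open import Function.Construct.Composition using (_⇔-∘_)
open import Function.Properties.Inverse using (↔⇒↣)
open import Relation.Binary.Definitions using (DecidableEquality)
open import Relation.Binary.PropositionalEquality using (refl; sym; trans; cong; cong₂; subst; subst₂; module ≡-Reasoning)
open import Relation.Nullary using (Dec; yes; does)
open import Relation.Nullary.Decidable using (_×-dec_; _⊎-dec_; does-⇔; dec-true; via-injection)

open Equivalence using (to; from)

Rel₃ : Set → Set₁
Rel₃ V = V → V → V → Set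

Decidable₃ : {V : Set} → Rel₃ V → Set
Decidable₃ R = ∀ x y z → Dec (R x y z)

⟦_⟧ : {V : Set} {R : Rel₃ V} → Decidable₃ R → Ternary V
⟦ R? ⟧ x y z = does (R? x y z)

does≡true⇒ : {A : Set} (a? : Dec A) → does a? ≡ true → A
does≡true⇒ (yes a) _ = a

isoVia-⟦⟧⇔ : {V : Set} {R S : Rel₃ V} (R? : Decidable₃ R) (S? : Decidable₃ S) (f : V → V) →
  IsoVia f ⟦ R? ⟧ ⟦ S? ⟧ ⇔ (∀ x y z → S (f x) (f y) (f z) ⇔ R x y z)
isoVia-⟦⟧⇔ R? S? f = mk⇔
  (λ iso x y z → mk⇔
    (λ s → does≡true⇒ (R? x y z) (trans (sym (iso x y z)) (dec-true (S? _ _ _) s)))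
    (λ r → does≡true⇒ (S? _ _ _) (trans (iso x y z) (dec-true (R? x y z) r))))
  (λ S∘f⇔R x y z → does-⇔ (S∘f⇔R x y z) (S? _ _ _) (R? x y z))

isCayley-⟦⟧ : {H : Set} {_∙_ : H → H → H} {R : Rel₃ H} (R? : Decidable₃ R) →
  (∀ g x y z → R (g ∙ x) (g ∙ y) (g ∙ z) ⇔ R x y z) → IsCayley _∙_ ⟦ R? ⟧
isCayley-⟦⟧ {_∙_ = _∙_} R? invariant g = from (isoVia-⟦⟧⇔ R? R? (g ∙_)) (invariant g)

module _ {H : Set} {_∙_ : H → H → H} where

  monochrome : Ternary H → ColorTernary H 1
  monochrome X = record { rel = λ _ → X ; disjoint = λ { zero zero _ _ _ _ _ → refl } }

  colorCI⇒CI : IsCI-ColorTernary _∙_ → IsCI-Ternary _∙_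
  colorCI⇒CI ci X Y cayX cayY = mk⇔
    (λ (f , f-iso) →
      let (σ , σ-iso) = to (ci 1 (monochrome X) (monochrome Y) (λ _ → cayX) (λ _ → cayY)) (f , λ _ → f-iso)
      in σ , σ-iso zero)
    (λ (σ , σ-iso) → proj₁ σ , σ-iso)

  isomorphic∧¬autIsomorphic⇒¬CI : (X Y : Ternary H) → IsCayley _∙_ X → IsCayley _∙_ Y → Isomorphic X Y →
    (∀ (σ : GroupAut _∙_) → ¬ IsoVia (Inverse.to (proj₁ σ)) X Y) → ¬ IsCI-Ternary _∙_
  isomorphic∧¬autIsomorphic⇒¬CI X Y cayX cayY X≅Y ¬aut ci =
    let (σ , σ-iso) = to (ci X Y cayX cayY) X≅Y in ¬aut σ σ-iso

module _ {A : Set} (f : A → A) where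
  open ≡-Reasoning

  iter-+ : ∀ m n x → iter f (m + n) x ≡ iter f m (iter f n x)
  iter-+ zero    n x = refl
  iter-+ (suc m) n x = cong f (iter-+ m n x)

  iter-suc : ∀ n x → iter f n (f x) ≡ f (iter f n x)
  iter-suc zero    x = refl
  iter-suc (suc n) x = cong f (iter-suc n x)

  iter-inverse : (g : A → A) → (∀ x → f (g x) ≡ x) → ∀ n x → iter f n (iter g n x) ≡ x
  iter-inverse g fg zero    x = refl
  iter-inverse g fg (suc n) x = begin
    f (iter f n (g (iter g n x))) ≡⟨ iter-suc n _ ⟨
    iter f n (f (g (iter g n x))) ≡⟨ cong (iter f n) (fg _) ⟩
    iter f n (iter g n x)         ≡⟨ iter-inverse g fg n x ⟩
    x                             ∎

  iter-periodic : ∀ {p} → (∀ x → iter f p x ≡ x) → ∀ k x → iter f (k * p) x ≡ x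
  iter-periodic         per zero    x = refl
  iter-periodic {p = p} per (suc k) x = begin
    iter f (p + k * p) x        ≡⟨ iter-+ p (k * p) x ⟩
    iter f p (iter f (k * p) x) ≡⟨ cong (iter f p) (iter-periodic per k x) ⟩
    iter f p x                  ≡⟨ per x ⟩
    x                           ∎

  iter-involution : ∀ {x} → f (f x) ≡ x →
    ∀ n → (2 ∣ n × iter f n x ≡ x) ⊎ (2 ∣ suc n × iter f n x ≡ f x)
  iter-involution ffx zero = inj₁ (2 ∣0 , refl)
  iter-involution ffx (suc n) with iter-involution ffx n
  ... | inj₁ (2∣n , e)   = inj₂ (∣m∣n⇒∣m+n ∣-refl 2∣n , cong f e)
  ... | inj₂ (2∣1+n , e) = inj₁ (2∣1+n , trans (cong f e) ffx)

  involution-odd-period : ∀ {p x} → f (f x) ≡ x → iter f p x ≡ x → ¬ 2 ∣ p → f x ≡ x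
  involution-odd-period {p} ffx fᵖx odd with iter-involution ffx p
  ... | inj₁ (2∣p , _)  = ⊥-elim (odd 2∣p)
  ... | inj₂ (_ , fᵖx≡fx) = trans (sym fᵖx≡fx) fᵖx

iter↔ : {A : Set} → A ↔ A → ℕ → A ↔ A
iter↔ f n = mk↔ₛ′ (iter (Inverse.to f) n) (iter (Inverse.from f) n)
  (iter-inverse (Inverse.to f) (Inverse.from f) (Inverse.strictlyInverseˡ f) n)
  (iter-inverse (Inverse.from f) (Inverse.to f) (Inverse.strictlyInverseʳ f) n)

module Cyclic (n : ℕ) (pp : Prime (suc n)) where
  open ≡-Reasoning

  private
    p : ℕ
    p = suc n

  infixl 6 _⊕_
  _⊕_ : Fin p → Fin p → Fin p
  _⊕_ = zpAdd p pp

  toℕ-⊕ : ∀ i j → toℕ (i ⊕ j) ≡ (toℕ i + toℕ j) % p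
  toℕ-⊕ i j = toℕ-fromℕ< _

  %-absorbʳ : ∀ a b → (a + b % p) % p ≡ (a + b) % p
  %-absorbʳ a b = begin
    (a + b % p) % p         ≡⟨ %-distribˡ-+ a (b % p) p ⟩
    (a % p + b % p % p) % p ≡⟨ cong (λ c → (a % p + c) % p) (m%n%n≡m%n b p) ⟩
    (a % p + b % p) % p     ≡⟨ %-distribˡ-+ a b p ⟨
    (a + b) % p             ∎

  %-absorbˡ : ∀ a b → (a % p + b) % p ≡ (a + b) % p
  %-absorbˡ a b = begin
    (a % p + b) % p ≡⟨ cong (_% p) (+-comm (a % p) b) ⟩
    (b + a % p) % p ≡⟨ %-absorbʳ b a ⟩
    (b + a) % p     ≡⟨ cong (_% p) (+-comm b a) ⟩
    (a + b) % p     ∎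

  ⊕-assoc : ∀ i j k → (i ⊕ j) ⊕ k ≡ i ⊕ (j ⊕ k)
  ⊕-assoc i j k = toℕ-injective (begin
    toℕ ((i ⊕ j) ⊕ k)                 ≡⟨ toℕ-⊕ (i ⊕ j) k ⟩
    (toℕ (i ⊕ j) + toℕ k) % p         ≡⟨ cong (λ c → (c + toℕ k) % p) (toℕ-⊕ i j) ⟩
    ((toℕ i + toℕ j) % p + toℕ k) % p ≡⟨ %-absorbˡ (toℕ i + toℕ j) (toℕ k) ⟩
    (toℕ i + toℕ j + toℕ k) % p       ≡⟨ cong (_% p) (+-assoc (toℕ i) (toℕ j) (toℕ k)) ⟩
    (toℕ i + (toℕ j + toℕ k)) % p     ≡⟨ %-absorbʳ (toℕ i) (toℕ j + toℕ k) ⟨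
    (toℕ i + (toℕ j + toℕ k) % p) % p ≡⟨ cong (λ c → (toℕ i + c) % p) (toℕ-⊕ j k) ⟨
    (toℕ i + toℕ (j ⊕ k)) % p         ≡⟨ toℕ-⊕ i (j ⊕ k) ⟨
    toℕ (i ⊕ (j ⊕ k))                 ∎)

  -- p ∸ toℕ i represents the inverse of i.
  toℕ-⊖⊕ : ∀ i j → ((p ∸ toℕ i) + toℕ (i ⊕ j)) % p ≡ toℕ j
  toℕ-⊖⊕ i j = begin
    ((p ∸ toℕ i) + toℕ (i ⊕ j)) % p           ≡⟨ cong (λ c → ((p ∸ toℕ i) + c) % p) (toℕ-⊕ i j) ⟩
    ((p ∸ toℕ i) + (toℕ i + toℕ j) % p) % p   ≡⟨ %-absorbʳ (p ∸ toℕ i) (toℕ i + toℕ j) ⟩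
    ((p ∸ toℕ i) + (toℕ i + toℕ j)) % p       ≡⟨ cong (_% p) (+-assoc (p ∸ toℕ i) (toℕ i) (toℕ j)) ⟨
    ((p ∸ toℕ i) + toℕ i + toℕ j) % p         ≡⟨ cong (λ c → (c + toℕ j) % p) (m∸n+n≡m (<⇒≤ (toℕ<n i))) ⟩
    (p + toℕ j) % p                           ≡⟨ cong (_% p) (+-comm p (toℕ j)) ⟩
    (toℕ j + p) % p                           ≡⟨ [m+n]%n≡m%n (toℕ j) p ⟩
    toℕ j % p                                 ≡⟨ m<n⇒m%n≡m (toℕ<n j) ⟩
    toℕ j                                     ∎

  ⊕-cancelˡ-⇔ : ∀ i j k → i ⊕ j ≡ i ⊕ k ⇔ j ≡ k
  ⊕-cancelˡ-⇔ i j k = mk⇔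
    (λ e → toℕ-injective (begin
      toℕ j                           ≡⟨ toℕ-⊖⊕ i j ⟨
      ((p ∸ toℕ i) + toℕ (i ⊕ j)) % p ≡⟨ cong (λ c → ((p ∸ toℕ i) + toℕ c) % p) e ⟩
      ((p ∸ toℕ i) + toℕ (i ⊕ k)) % p ≡⟨ toℕ-⊖⊕ i k ⟩
      toℕ k                           ∎))
    (cong (i ⊕_))

  ⊕-translate-⇔ : ∀ t i j c → t ⊕ j ≡ (t ⊕ i) ⊕ c ⇔ j ≡ i ⊕ c
  ⊕-translate-⇔ t i j c = subst (λ r → t ⊕ j ≡ r ⇔ j ≡ i ⊕ c) (sym (⊕-assoc t i c)) (⊕-cancelˡ-⇔ t j (i ⊕ c))

  ⊕-idempotent⇒zero : ∀ i → i ⊕ i ≡ i → i ≡ zero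
  ⊕-idempotent⇒zero i ii≡i = to (⊕-cancelˡ-⇔ i i zero) (trans ii≡i (sym i⊕0≡i))
    where
    i⊕0≡i : i ⊕ zero ≡ i
    i⊕0≡i = toℕ-injective (trans (toℕ-⊕ i zero)
      (trans (cong (_% p) (+-comm (toℕ i) 0)) (m<n⇒m%n≡m (toℕ<n i))))

  module _ {A : Set} (f : A → A) (per : ∀ x → iter f p x ≡ x) where

    iter-% : ∀ m x → iter f (m % p) x ≡ iter f m x
    iter-% m x = begin
      iter f (m % p) x                      ≡⟨ cong (iter f (m % p)) (iter-periodic f per (m / p) x) ⟨
      iter f (m % p) (iter f (m / p * p) x) ≡⟨ iter-+ f (m % p) (m / p * p) x ⟨
      iter f (m % p + m / p * p) x          ≡⟨ cong (λ k → iter f k x) (m≡m%n+[m/n]*n m p) ⟨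
      iter f m x                            ∎

    iter-⊕ : ∀ i j x → iter f (toℕ (i ⊕ j)) x ≡ iter f (toℕ i) (iter f (toℕ j) x)
    iter-⊕ i j x = begin
      iter f (toℕ (i ⊕ j)) x             ≡⟨ cong (λ k → iter f k x) (toℕ-⊕ i j) ⟩
      iter f ((toℕ i + toℕ j) % p) x     ≡⟨ iter-% (toℕ i + toℕ j) x ⟩
      iter f (toℕ i + toℕ j) x           ≡⟨ iter-+ f (toℕ i) (toℕ j) x ⟩
      iter f (toℕ i) (iter f (toℕ j) x) ∎

module Endomorphisms (G : FinAbGroup) where
  open FinAbGroup G renaming (Carrier to C)
  open ≡-Reasoning

  abelianGroup : AbelianGroup _ _
  abelianGroup = record { isAbelianGroup = isAbelianGroup }

  open AbelianGroup abelianGroup public using (comm; identityˡ; identityʳ; inverseʳ)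
  open AbelianGroupProperties abelianGroup public using (∙-cancelˡ)
  open CommutativeSemigroupProperties (AbelianGroup.commutativeSemigroup abelianGroup) using (interchange)

  _≟C_ : DecidableEquality C
  _≟C_ = via-injection (↔⇒↣ enum) _≟_

  ∙-cancelˡ-⇔ : ∀ c x y → c ∙ x ≡ c ∙ y ⇔ x ≡ y
  ∙-cancelˡ-⇔ c x y = mk⇔ (∙-cancelˡ c x y) (cong (c ∙_))

  ≡-resp-⇔ : ∀ {x x′ y y′ : C} → x ≡ x′ → y ≡ y′ → x ≡ y ⇔ x′ ≡ y′
  ≡-resp-⇔ refl refl = mk⇔ id id

  hom-0# : ∀ {f} → IsHom _∙_ f → f 0# ≡ 0#
  hom-0# {f} f-hom = sym (∙-cancelˡ (f 0#) 0# (f 0#) (begin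
    f 0# ∙ 0#    ≡⟨ identityʳ (f 0#) ⟩
    f 0#         ≡⟨ cong f (identityˡ 0#) ⟨
    f (0# ∙ 0#)  ≡⟨ f-hom 0# 0# ⟩
    f 0# ∙ f 0#  ∎))

  iter-hom : ∀ {f} → IsHom _∙_ f → ∀ n → IsHom _∙_ (iter f n)
  iter-hom         f-hom zero    x y = refl
  iter-hom {f = f} f-hom (suc n) x y = trans (cong f (iter-hom f-hom n x y)) (f-hom _ _)

  injective-hom-⇔ : ∀ {g} → IsHom _∙_ g → (∀ {x y} → g x ≡ g y → x ≡ y) →
    ∀ u v w z → g u ∙ g v ≡ g w ∙ g z ⇔ u ∙ v ≡ w ∙ z
  injective-hom-⇔ {g} g-hom g-inj u v w z =
    mk⇔ g-inj (cong g) ⇔-∘ ≡-resp-⇔ (sym (g-hom u v)) (sym (g-hom w z))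

  module Balance (a : C → C) (a-hom : IsHom _∙_ a) where

    Balanced : C → C → C → C → Set
    Balanced u v w z = u ∙ a v ≡ w ∙ a z

    balanced-translate : ∀ h u v w z → Balanced (h ∙ u) (h ∙ v) (h ∙ w) (h ∙ z) ⇔ Balanced u v w z
    balanced-translate h u v w z =
      ∙-cancelˡ-⇔ (h ∙ a h) (u ∙ a v) (w ∙ a z) ⇔-∘ ≡-resp-⇔ (expand u v) (expand w z)
      where
      expand : ∀ x y → (h ∙ x) ∙ a (h ∙ y) ≡ (h ∙ a h) ∙ (x ∙ a y)
      expand x y = trans (cong ((h ∙ x) ∙_) (a-hom h y)) (interchange h x (a h) (a y))

    balanced-map : ∀ {g} → IsHom _∙_ g → (∀ {x y} → g x ≡ g y → x ≡ y) → (∀ x → g (a x) ≡ a (g x)) →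
      ∀ u v w z → Balanced (g u) (g v) (g w) (g z) ⇔ Balanced u v w z
    balanced-map g-hom g-inj ga≡ag u v w z =
      injective-hom-⇔ g-hom g-inj u (a v) w (a z)
      ⇔-∘ ≡-resp-⇔ (cong (_ ∙_) (sym (ga≡ag v))) (cong (_ ∙_) (sym (ga≡ag z)))

module Counterexample (G : FinAbGroup) (q : ℕ) (pp : Prime (3 + q))
  (α : FinAbGroup.Carrier G ↔ FinAbGroup.Carrier G)
  (α-hom : IsHom (FinAbGroup._∙_ G) (Inverse.to α)) where

  open FinAbGroup G renaming (Carrier to C)
  open Endomorphisms G
  open Cyclic (2 + q) pp
  open ≡-Reasoning

  a : C → C
  a = Inverse.to α

  open Balance a α-hom

  p : ℕ
  p = 3 + q

  one : Fin p
  one = suc zero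

  Point : Set
  Point = Fin p × C

  _·_ : Point → Point → Point
  _·_ = prodOp p pp G

  O : Point
  O = zero , 0#

  Rising : (C → C → C → Set) → Rel₃ Point
  Rising B (i , x) (j , y) (k , z) = j ≡ i ⊕ one × k ≡ j ⊕ one × B x y z

  Flat : Rel₃ Point
  Flat (i , x) (j , y) (k , z) = j ≡ i × k ≡ i × Balanced z x x y

  RisingX RisingY : C → C → C → Set
  RisingX x y z = Balanced x z y y
  RisingY x y z = Balanced z x y y

  X Y : Rel₃ Point
  X x y z = Rising RisingX x y z ⊎ Flat x y z
  Y x y z = Rising RisingY x y z ⊎ Flat x y z

  balanced? : ∀ u v w z → Dec (Balanced u v w z)
  balanced? u v w z = (u ∙ a v) ≟C (w ∙ a z)

  rising? : ∀ {B} → (∀ x y z → Dec (B x y z)) → Decidable₃ (Rising B)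
  rising? B? (i , x) (j , y) (k , z) = (j ≟ i ⊕ one) ×-dec (k ≟ j ⊕ one) ×-dec B? x y z

  flat? : Decidable₃ Flat
  flat? (i , x) (j , y) (k , z) = (j ≟ i) ×-dec (k ≟ i) ×-dec balanced? z x x y

  X? : Decidable₃ X
  X? x y z = rising? (λ u v w → balanced? u w v v) x y z ⊎-dec flat? x y z

  Y? : Decidable₃ Y
  Y? x y z = rising? (λ u v w → balanced? w u v v) x y z ⊎-dec flat? x y z

  rising-translate : ∀ {B} → (∀ h x y z → B (h ∙ x) (h ∙ y) (h ∙ z) ⇔ B x y z) →
    ∀ t x y z → Rising B (t · x) (t · y) (t · z) ⇔ Rising B x y z
  rising-translate B-inv (t , h) (i , x) (j , y) (k , z) =
    ⊕-translate-⇔ t i j one ×-⇔ ⊕-translate-⇔ t j k one ×-⇔ B-inv h x y z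

  flat-translate : ∀ t x y z → Flat (t · x) (t · y) (t · z) ⇔ Flat x y z
  flat-translate (t , h) (i , x) (j , y) (k , z) =
    ⊕-cancelˡ-⇔ t j i ×-⇔ ⊕-cancelˡ-⇔ t k i ×-⇔ balanced-translate h z x x y

  X-cayley : IsCayley _·_ ⟦ X? ⟧
  X-cayley = isCayley-⟦⟧ X? λ t x y z →
    rising-translate (λ h x y z → balanced-translate h x z y y) t x y z ⊎-⇔ flat-translate t x y z

  Y-cayley : IsCayley _·_ ⟦ Y? ⟧
  Y-cayley = isCayley-⟦⟧ Y? λ t x y z →
    rising-translate (λ h x y z → balanced-translate h z x y y) t x y z ⊎-⇔ flat-translate t x y z

  α-injective : ∀ {x y} → a x ≡ a y → x ≡ y
  α-injective = Injection.injective (↔⇒↣ α)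

  module _ (α-period : ∀ x → iter a p x ≡ x) where

    power : Fin p → C → C
    power i = iter a (toℕ i)

    balanced-power : ∀ i u v w z → Balanced (power i u) (power i v) (power i w) (power i z) ⇔ Balanced u v w z
    balanced-power i = balanced-map (iter-hom α-hom (toℕ i))
      (Injection.injective (↔⇒↣ (iter↔ α (toℕ i)))) (iter-suc a (toℕ i))

    rising-balance : ∀ i x y z →
      RisingY (power i x) (power (i ⊕ one) y) (power (i ⊕ one ⊕ one) z) ⇔ RisingX x y z
    rising-balance i x y z =
      ≡-resp-⇔ (comm (a z) x) refl
      ⇔-∘ (injective-hom-⇔ α-hom α-injective (a z) x y (a y)
      ⇔-∘ (balanced-power i (a (a z)) x (a y) (a y)
      ⇔-∘ ≡-resp-⇔ (cong (_∙ a (power i x)) shift²) (cong₂ (λ u v → u ∙ a v) shift shift)))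
      where
      shift : power (i ⊕ one) y ≡ power i (a y)
      shift = iter-⊕ a α-period i one y
      shift² : power (i ⊕ one ⊕ one) z ≡ power i (a (a z))
      shift² = trans (iter-⊕ a α-period (i ⊕ one) one z) (iter-⊕ a α-period i one (a z))

    φ : Point ↔ Point
    φ = mk↔ₛ′ (λ (i , x) → i , power i x) (λ (i , x) → i , Inverse.from (iter↔ α (toℕ i)) x)
      (λ (i , x) → cong (i ,_) (Inverse.strictlyInverseˡ (iter↔ α (toℕ i)) x))
      (λ (i , x) → cong (i ,_) (Inverse.strictlyInverseʳ (iter↔ α (toℕ i)) x))

    φ-rising : ∀ x y z → Rising RisingY (Inverse.to φ x) (Inverse.to φ y) (Inverse.to φ z) ⇔ Rising RisingX x y z
    φ-rising (i , x) (j , y) (k , z) = mk⇔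
      (λ { (refl , refl , b) → refl , refl , to (rising-balance i x y z) b })
      (λ { (refl , refl , b) → refl , refl , from (rising-balance i x y z) b })

    φ-flat : ∀ x y z → Flat (Inverse.to φ x) (Inverse.to φ y) (Inverse.to φ z) ⇔ Flat x y z
    φ-flat (i , x) (j , y) (k , z) = mk⇔
      (λ { (refl , refl , b) → refl , refl , to (balanced-power i z x x y) b })
      (λ { (refl , refl , b) → refl , refl , from (balanced-power i z x x y) b })

    X≅Y : Isomorphic ⟦ X? ⟧ ⟦ Y? ⟧
    X≅Y = φ , from (isoVia-⟦⟧⇔ X? Y? (Inverse.to φ)) λ x y z → φ-rising x y z ⊎-⇔ φ-flat x y z

  identityʳ-α0# : ∀ u → u ∙ a 0# ≡ u
  identityʳ-α0# u = trans (cong (u ∙_) (hom-0# α-hom)) (identityʳ u)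

  O·O≡O : O · O ≡ O
  O·O≡O = cong (zero ,_) (identityˡ 0#)

  ¬X-descending : ¬ X (one ⊕ one , 0#) (one , 0#) O
  ¬X-descending (inj₁ (1≡3 , _)) with to (⊕-cancelˡ-⇔ one zero (one ⊕ one)) (trans 1≡3 (⊕-assoc one one one))
  ... | ()
  ¬X-descending (inj₂ (() , _))

  X-flat-from-O : ∀ g → X O (zero , g) (zero , a g)
  X-flat-from-O g = inj₂ (refl , refl , trans (identityʳ-α0# (a g)) (sym (identityˡ (a g))))

  X-rising-from-O : ∀ h → X O (one , a h) (one ⊕ one , a h ∙ h)
  X-rising-from-O h = inj₁ (refl , refl , trans (identityˡ _) (trans (α-hom (a h) h) (comm (a (a h)) (a h))))

  ·-idempotent⇒O : ∀ w → w · w ≡ w → w ≡ O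
  ·-idempotent⇒O (i , x) ww≡w = cong₂ _,_
    (⊕-idempotent⇒zero i (cong proj₁ ww≡w))
    (∙-cancelˡ x x 0# (trans (cong proj₂ ww≡w) (sym (identityʳ x))))

  Y-from-O⇒fibre-one-or-zero : ∀ w w′ → Y O w w′ → proj₁ w ≡ one ⊎ proj₁ w ≡ zero
  Y-from-O⇒fibre-one-or-zero w w′ (inj₁ (w₁≡one , _))  = inj₁ w₁≡one
  Y-from-O⇒fibre-one-or-zero w w′ (inj₂ (w₁≡zero , _)) = inj₂ w₁≡zero

  ⊕≡zero-on-zero-or-one : ∀ i j → i ≡ one ⊎ i ≡ zero → j ≡ one ⊎ j ≡ zero → i ⊕ j ≡ zero → i ≡ zero
  ⊕≡zero-on-zero-or-one _ _ (inj₁ refl) (inj₁ refl) ()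
  ⊕≡zero-on-zero-or-one _ _ (inj₁ refl) (inj₂ refl) ()
  ⊕≡zero-on-zero-or-one _ _ (inj₂ i≡zero) _ _ = i≡zero

  module _ (p-odd : ¬ 2 ∣ p) (α-period : ∀ x → iter a p x ≡ x)
    (α-fixed-point-free : ∀ x → a x ≡ x → x ≡ 0#) (α-nontrivial : ¬ (∀ x → a x ≡ x)) where

    α²-fixed⇒0# : ∀ x → a (a x) ≡ x → x ≡ 0#
    α²-fixed⇒0# x aax≡x = α-fixed-point-free x (involution-odd-period a aax≡x (α-period x) p-odd)

    -- In the flat case the reversed triple would lie in the flat part of Y as well.
    Y-square⇒generator : ∀ w → Y O w (w · w) → ¬ Y (w · w) w O → w ≡ (one , 0#)
    Y-square⇒generator (i , x) (inj₁ (i≡one , _ , b)) _ =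
      cong₂ _,_ i≡one (α-fixed-point-free x (sym (∙-cancelˡ x x (a x) (trans (sym (identityʳ-α0# (x ∙ x))) b))))
    Y-square⇒generator (i , x) (inj₂ (refl , _ , b)) ¬Y = ⊥-elim (¬Y (inj₂ (refl , refl , b′)))
      where
      x∙x≡ax : x ∙ x ≡ a x
      x∙x≡ax = trans (sym (identityʳ-α0# (x ∙ x))) (trans b (identityˡ (a x)))
      b′ : Balanced 0# (x ∙ x) (x ∙ x) x
      b′ = begin
        0# ∙ a (x ∙ x) ≡⟨ identityˡ _ ⟩
        a (x ∙ x)      ≡⟨ α-hom x x ⟩
        a x ∙ a x      ≡⟨ cong (_∙ a x) x∙x≡ax ⟨
        (x ∙ x) ∙ a x  ∎

    module _ (σ : GroupAut _·_) (σ-iso : IsoVia (Inverse.to (proj₁ σ)) ⟦ X? ⟧ ⟦ Y? ⟧) where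

      s : Point → Point
      s = Inverse.to (proj₁ σ)

      s-hom : IsHom _·_ s
      s-hom = proj₂ σ

      s-O : s O ≡ O
      s-O = ·-idempotent⇒O (s O) (trans (sym (s-hom O O)) (cong s O·O≡O))

      s-preserves : ∀ y z → X O y z → Y O (s y) (s z)
      s-preserves y z xyz = subst (λ o → Y o (s y) (s z)) s-O (from (to (isoVia-⟦⟧⇔ X? Y? s) σ-iso O y z) xyz)

      s-reflects : ∀ x y → Y (s x) (s y) O → X x y O
      s-reflects x y sxyz = to (to (isoVia-⟦⟧⇔ X? Y? s) σ-iso x y O) (subst (Y (s x) (s y)) (sym s-O) sxyz)

      Y-s-flat : ∀ g → Y O (s (zero , g)) (s (zero , a g))
      Y-s-flat g = s-preserves (zero , g) (zero , a g) (X-flat-from-O g)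

      s-zero-fibre : ∀ g → proj₁ (s (zero , g)) ≡ zero
      s-zero-fibre g = ⊕≡zero-on-zero-or-one _ _
        (Y-from-O⇒fibre-one-or-zero _ _ (Y-s-flat g)) (Y-from-O⇒fibre-one-or-zero _ _ (Y-s-flat (- g)))
        (cong proj₁ (trans (sym (s-hom (zero , g) (zero , - g))) (trans (cong (s ∘ (zero ,_)) (inverseʳ g)) s-O)))

      γ : C → C
      γ g = proj₂ (s (zero , g))

      s-zero : ∀ g → s (zero , g) ≡ (zero , γ g)
      s-zero g = cong (_, γ g) (s-zero-fibre g)

      γ-commutes : ∀ g → γ (a g) ≡ a (γ g)
      γ-commutes g with subst₂ (Y O) (s-zero g) (s-zero (a g)) (Y-s-flat g)
      ... | inj₂ (_ , _ , b) = trans (sym (identityʳ-α0# (γ (a g)))) (trans b (identityˡ (a (γ g))))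

      s-one : s (one , 0#) ≡ (one , 0#)
      s-one = Y-square⇒generator c Y-O-c-c² ¬Y-c²-c-O
        where
        c : Point
        c = s (one , 0#)
        s-two : s (one ⊕ one , 0#) ≡ c · c
        s-two = trans (cong (s ∘ (one ⊕ one ,_)) (sym (identityˡ 0#))) (s-hom (one , 0#) (one , 0#))
        Y-O-c-c² : Y O c (c · c)
        Y-O-c-c² = subst (Y O c) s-two (s-preserves (one , 0#) (one ⊕ one , 0#) (inj₁ (refl , refl , refl)))
        ¬Y-c²-c-O : ¬ Y (c · c) c O
        ¬Y-c²-c-O = ¬X-descending ∘ s-reflects (one ⊕ one , 0#) (one , 0#) ∘ subst (λ w → Y w c O) (sym s-two)

      s-one-fibre : ∀ g → s (one , g) ≡ (one , γ g)
      s-one-fibre g = begin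
        s (one , g)                  ≡⟨ cong (s ∘ (one ,_)) (identityˡ g) ⟨
        s ((one , 0#) · (zero , g))  ≡⟨ s-hom (one , 0#) (zero , g) ⟩
        s (one , 0#) · s (zero , g)  ≡⟨ cong₂ _·_ s-one (s-zero g) ⟩
        (one , 0#) · (zero , γ g)    ≡⟨ cong (one ,_) (identityˡ (γ g)) ⟩
        (one , γ g)                  ∎

      s-two-fibre : ∀ g h → s (one ⊕ one , g ∙ h) ≡ (one ⊕ one , γ g ∙ γ h)
      s-two-fibre g h = trans (s-hom (one , g) (one , h)) (cong₂ _·_ (s-one-fibre g) (s-one-fibre h))

      γ-α²-fixed : ∀ h → a (a (γ h)) ≡ γ h
      γ-α²-fixed h
        with subst₂ (Y O) (s-one-fibre (a h)) (s-two-fibre (a h) h) (s-preserves _ _ (X-rising-from-O h))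
      ... | inj₁ (_ , _ , b) = sym (trans
        (∙-cancelˡ (γ (a h)) (γ h) (a (γ (a h))) (trans (sym (identityʳ-α0# _)) b))
        (cong a (γ-commutes h)))

      γ≡0# : ∀ h → γ h ≡ 0#
      γ≡0# h = α²-fixed⇒0# (γ h) (γ-α²-fixed h)

      G-trivial : ∀ h → h ≡ 0#
      G-trivial h = cong proj₂ (Injection.injective (↔⇒↣ (proj₁ σ))
        (trans (s-zero h) (trans (cong (zero ,_) (γ≡0# h)) (sym s-O))))

      not-via-automorphism : ⊥
      not-via-automorphism = α-nontrivial λ x → trans (G-trivial (a x)) (sym (G-trivial x))

    ¬CI : ¬ IsCI-Ternary _·_
    ¬CI = isomorphic∧¬autIsomorphic⇒¬CI ⟦ X? ⟧ ⟦ Y? ⟧ X-cayley Y-cayley (X≅Y α-period) not-via-automorphism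

-- The hypothesis on a structure with automorphism group ⟨G_L, α⟩ is deliberately unused:
-- the structures X and Y above are already uncoloured.
theorem2p1 : (G : FinAbGroup) (p : ℕ) (pp : Prime p) → ¬ (2 ∣ p) →
    (α : FinAbGroup.Carrier G ↔ FinAbGroup.Carrier G) →
    IsHom (FinAbGroup._∙_ G) (Inverse.to α) →
    (∀ x → iter (Inverse.to α) p x ≡ x) →
    (∀ k → 0 < k → k < p → ¬ (∀ x → iter (Inverse.to α) k x ≡ x)) →
    (∀ x → Inverse.to α x ≡ x → x ≡ FinAbGroup.0# G) →
    ¬ IsCI-ColorTernary (prodOp p pp G)
    × ((Σ (Ternary (FinAbGroup.Carrier G)) λ X →
          ∀ (f : FinAbGroup.Carrier G ↔ FinAbGroup.Carrier G) →
            IsAut X f ⇔ InGenerated G α (Inverse.to f))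
       → ¬ IsCI-Ternary (prodOp p pp G))
theorem2p1 G 2 pp odd _ _ _ _ _ = ⊥-elim (odd ∣-refl)
theorem2p1 G (suc (suc (suc q))) pp odd α α-hom α-period α-order α-fixed-point-free =
  ¬CI ∘ colorCI⇒CI , λ _ → ¬CI
  where
  ¬CI : ¬ IsCI-Ternary (prodOp (3 + q) pp G)
  ¬CI = Counterexample.¬CI G q pp α α-hom odd α-period α-fixed-point-free
    (α-order 1 (s≤s z≤n) (s≤s (s≤s z≤n)))
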